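{- Let $P:\mathcal{C}^{op}\to\mathbf{InfSL}$ be an elementary doctrine and let $A$ be an object of $\mathcal{C}$. If the diagonal $\Delta_A:A\to A\times A$ is a stable comprehension (resp. stable weak comprehension) of $\delta_A$, then every pair of parallel arrows $f,g:X\to A$ in $\mathcal{C}$ has an equalizer (resp. a weak equalizer).
   Context: A primary doctrine is a functor $P:\mathcal{C}^{op}\to\mathbf{InfSL}$ where $\mathcal{C}$ has finite products, each $P(A)$ is a poset with finite meets (top $\top_A$) and each $P_f$ preserves them. Write $f\times f'=\langle f\circ pr_1,f'\circ pr_2\rangle$, $\Delta_A=\langle id_A,id_A\rangle$. $P$ is elementary if each $P_{id_C\times\Delta_A}:P(C\times(A\times A))\to P(C\times A)$ has a left adjoint $\exists_{id_C\times\Delta_A}$ satisfying Frobenius reciprocity $\exists(P_{id_C\times\Delta_A}(\alpha)\wedge\beta)=\alpha\wedge\exists(\beta)$; $\delta_A=\exists_{\Delta_A}(\top_A)\in P(A\times A)$. A comprehension of $\alpha\in P(A)$ is an arrow $\{\alpha\}:X\to A$ with $\top_X\le P_{\{\alpha\}}(\alpha)$ such that every $g:Y\to A$ with $\top_Y\le P_g(\alpha)$ factors uniquely through $\{\alpha\}$; it is stable if for every $f:A'\to A$, $P_f(\alpha)$ has a comprehension. A weak comprehension is defined likewise with the factorization not required unique; it is stable if for every $f:A'\to A$, $P_f(\alpha)$ has a weak comprehension $\{P_f(\alpha)\}:X'\to A'$ and there is a weak pullback square formed by $\{P_f(\alpha)\}$, $f$, $\{\alpha\}$ and some $f':X'\to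 X$. -}

module Defs where

open import Level using (Level; _⊔_) renaming (suc to lsuc)
open import Relation.Binary.PropositionalEquality using (_≡_)
open import Data.Product using (Σ; ∃; ∃!; _×_; _,_)

record Category (o ℓ : Level) : Set (lsuc (o ⊔ ℓ)) where
  infixr 9 _∘_
  field
    Obj  : Set o
    _⇒_  : Obj → Obj → Set ℓ
    id   : ∀ {A} → A ⇒ A
    _∘_  : ∀ {A B C} → B ⇒ C → A ⇒ B → A ⇒ C
    identityˡ : ∀ {A B} {f : A ⇒ B} → id ∘ f ≡ f
    identityʳ : ∀ {A B} {f : A ⇒ B} → f ∘ id ≡ f
    assoc     : ∀ {A B C D} {f : A ⇒ B} {g : B ⇒ C} {h : C ⇒ D} →
                (h ∘ g) ∘ f ≡ h ∘ (g ∘ f)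

record FiniteProducts {o ℓ} (𝒞 : Category o ℓ) : Set (o ⊔ ℓ) where
  open Category 𝒞
  infixr 7 _⊗_
  field
    𝟙       : Obj
    !       : ∀ {A} → A ⇒ 𝟙
    !-unique : ∀ {A} (f : A ⇒ 𝟙) → f ≡ !
    _⊗_     : Obj → Obj → Obj
    π₁      : ∀ {A B} → (A ⊗ B) ⇒ A
    π₂      : ∀ {A B} → (A ⊗ B) ⇒ B
    ⟨_,_⟩   : ∀ {X A B} → X ⇒ A → X ⇒ B → X ⇒ (A ⊗ B)
    project₁ : ∀ {X A B} {f : X ⇒ A} {g : X ⇒ B} → π₁ ∘ ⟨ f , g ⟩ ≡ f
    project₂ : ∀ {X A B} {f : X ⇒ A} {g : X ⇒ B} → π₂ ∘ ⟨ f , g ⟩ ≡ g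
    ⟨⟩-unique : ∀ {X A B} {f : X ⇒ A} {g : X ⇒ B} {h : X ⇒ (A ⊗ B)} →
                π₁ ∘ h ≡ f → π₂ ∘ h ≡ g → ⟨ f , g ⟩ ≡ h

  _⊗₁_ : ∀ {A B A' B'} → A ⇒ B → A' ⇒ B' → (A ⊗ A') ⇒ (B ⊗ B')
  f ⊗₁ f' = ⟨ f ∘ π₁ , f' ∘ π₂ ⟩

  Δ : ∀ {A} → A ⇒ (A ⊗ A)
  Δ = ⟨ id , id ⟩

record PrimaryDoctrine {o ℓ} (𝒞 : Category o ℓ) (p r : Level)
       : Set (o ⊔ ℓ ⊔ lsuc (p ⊔ r)) where
  open Category 𝒞
  infix 4 _≤_
  infixr 6 _∧_
  field
    P     : Obj → Set p
    _≤_   : ∀ {A} → P A → P A → Set r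
    ≤-refl    : ∀ {A} {α : P A} → α ≤ α
    ≤-trans   : ∀ {A} {α β γ : P A} → α ≤ β → β ≤ γ → α ≤ γ
    ≤-antisym : ∀ {A} {α β : P A} → α ≤ β → β ≤ α → α ≡ β
    ⊤     : ∀ {A} → P A
    ⊤-max : ∀ {A} {α : P A} → α ≤ ⊤
    _∧_   : ∀ {A} → P A → P A → P A
    ∧-lb₁ : ∀ {A} {α β : P A} → α ∧ β ≤ α
    ∧-lb₂ : ∀ {A} {α β : P A} → α ∧ β ≤ β
    ∧-glb : ∀ {A} {α β γ : P A} → γ ≤ α → γ ≤ β → γ ≤ α ∧ β
    Pₘ     : ∀ {A B} → A ⇒ B → P B → P A
    Pₘ-id  : ∀ {A} {α : P A} → Pₘ id α ≡ α
    Pₘ-∘   : ∀ {A B C} {f : A ⇒ B} {g : B ⇒ C} {α : P C} →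
             Pₘ (g ∘ f) α ≡ Pₘ f (Pₘ g α)
    Pₘ-⊤   : ∀ {A B} {f : A ⇒ B} → Pₘ f ⊤ ≡ ⊤
    Pₘ-∧   : ∀ {A B} {f : A ⇒ B} {α β : P B} → Pₘ f (α ∧ β) ≡ Pₘ f α ∧ Pₘ f β

record Elementary {o ℓ p r} {𝒞 : Category o ℓ} (FP : FiniteProducts 𝒞)
       (D : PrimaryDoctrine 𝒞 p r) : Set (o ⊔ ℓ ⊔ p ⊔ r) where
  open Category 𝒞
  open FiniteProducts FP
  open PrimaryDoctrine D
  field
    ∃Δ   : ∀ {C A} → P (C ⊗ A) → P (C ⊗ (A ⊗ A))
    ∃Δ⊣₁ : ∀ {C A} {β : P (C ⊗ A)} {α : P (C ⊗ (A ⊗ A))} →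
           ∃Δ β ≤ α → β ≤ Pₘ (id ⊗₁ Δ) α
    ∃Δ⊣₂ : ∀ {C A} {β : P (C ⊗ A)} {α : P (C ⊗ (A ⊗ A))} →
           β ≤ Pₘ (id ⊗₁ Δ) α → ∃Δ β ≤ α
    frobenius : ∀ {C A} {α : P (C ⊗ (A ⊗ A))} {β : P (C ⊗ A)} →
                ∃Δ (Pₘ (id ⊗₁ Δ) α ∧ β) ≡ α ∧ ∃Δ β

  -- ∃_{Δ_A} is ∃_{id_𝟙 × Δ_A} transported along the iso 𝟙 × A ≅ A, so
  -- δ_A = ∃_{Δ_A}(⊤_A) = P_{⟨!,id⟩}(∃_{id_𝟙 × Δ_A}(⊤_{𝟙 × A})).
  δ : ∀ {A} → P (A ⊗ A)
  δ = Pₘ ⟨ ! , id ⟩ (∃Δ {𝟙} ⊤)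

module _ {o ℓ p r} {𝒞 : Category o ℓ} (D : PrimaryDoctrine 𝒞 p r) where
  open Category 𝒞
  open PrimaryDoctrine D

  IsComprehension : ∀ {X A} → X ⇒ A → P A → Set (o ⊔ ℓ ⊔ r)
  IsComprehension {X} {A} c α =
    (⊤ ≤ Pₘ c α) ×
    (∀ {Y} (g : Y ⇒ A) → ⊤ ≤ Pₘ g α → ∃! _≡_ (λ (h : Y ⇒ X) → c ∘ h ≡ g))

  IsWeakComprehension : ∀ {X A} → X ⇒ A → P A → Set (o ⊔ ℓ ⊔ r)
  IsWeakComprehension {X} {A} c α =
    (⊤ ≤ Pₘ c α) ×
    (∀ {Y} (g : Y ⇒ A) → ⊤ ≤ Pₘ g α → Σ (Y ⇒ X) (λ h → c ∘ h ≡ g))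

  HasComprehension : ∀ {A} → P A → Set (o ⊔ ℓ ⊔ r)
  HasComprehension {A} α = Σ Obj λ X → Σ (X ⇒ A) λ c → IsComprehension c α

  IsStableComprehension : ∀ {X A} → X ⇒ A → P A → Set (o ⊔ ℓ ⊔ r)
  IsStableComprehension {X} {A} c α =
    IsComprehension c α × (∀ {A'} (f : A' ⇒ A) → HasComprehension (Pₘ f α))

  IsWeakPullback : ∀ {X A X' A'} (c : X ⇒ A) (f : A' ⇒ A) (c' : X' ⇒ A')
                   (f' : X' ⇒ X) → Set (o ⊔ ℓ)
  IsWeakPullback {X} {A} {X'} {A'} c f c' f' =
    (c ∘ f' ≡ f ∘ c') ×
    (∀ {Z} (u : Z ⇒ A') (v : Z ⇒ X) → f ∘ u ≡ c ∘ v →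
       Σ (Z ⇒ X') λ w → (c' ∘ w ≡ u) × (f' ∘ w ≡ v))

  IsStableWeakComprehension : ∀ {X A} → X ⇒ A → P A → Set (o ⊔ ℓ ⊔ r)
  IsStableWeakComprehension {X} {A} c α =
    IsWeakComprehension c α ×
    (∀ {A'} (f : A' ⇒ A) →
       Σ Obj λ X' → Σ (X' ⇒ A') λ c' → Σ (X' ⇒ X) λ f' →
         IsWeakComprehension c' (Pₘ f α) × IsWeakPullback c f c' f')

module _ {o ℓ} (𝒞 : Category o ℓ) where
  open Category 𝒞

  HasEqualizer : ∀ {X A} → X ⇒ A → X ⇒ A → Set (o ⊔ ℓ)
  HasEqualizer {X} {A} f g =
    Σ Obj λ E → Σ (E ⇒ X) λ e → (f ∘ e ≡ g ∘ e) ×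
      (∀ {Y} (h : Y ⇒ X) → f ∘ h ≡ g ∘ h → ∃! _≡_ (λ (k : Y ⇒ E) → e ∘ k ≡ h))

  HasWeakEqualizer : ∀ {X A} → X ⇒ A → X ⇒ A → Set (o ⊔ ℓ)
  HasWeakEqualizer {X} {A} f g =
    Σ Obj λ E → Σ (E ⇒ X) λ e → (f ∘ e ≡ g ∘ e) ×
      (∀ {Y} (h : Y ⇒ X) → f ∘ h ≡ g ∘ h → Σ (Y ⇒ E) λ k → e ∘ k ≡ h)

-- Since Δ is a weak comprehension of δ, a global truth ⊤ ≤ P_u δ for
-- u : Y → A × A says exactly that u factors through Δ, i.e. π₁ u = π₂ u.
-- Reindexing along ⟨f, g⟩, the predicate P_⟨f,g⟩ δ on X therefore holds along
-- h : Y → X exactly when f h = g h, so a (weak) comprehension of it, which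
-- exists by stability, is a (weak) equalizer of f and g.
module Submission where

open import Defs
open import Level using (Level; _⊔_)
open import Data.Product using (Σ; _×_; _,_)
open import Function.Bundles using (_⇔_; mk⇔; Equivalence)
open import Function.Construct.Composition using (_⇔-∘_)
open import Relation.Binary.PropositionalEquality
  using (_≡_; refl; sym; trans; cong; cong₂; subst; subst₂; module ≡-Reasoning)

module Products {o ℓ} {𝒞 : Category o ℓ} (FP : FiniteProducts 𝒞) where
  open Category 𝒞
  open FiniteProducts FP
  open ≡-Reasoning

  ⟨⟩-∘ : ∀ {Y X B C} {f : X ⇒ B} {g : X ⇒ C} {h : Y ⇒ X} →
         ⟨ f , g ⟩ ∘ h ≡ ⟨ f ∘ h , g ∘ h ⟩
  ⟨⟩-∘ {f = f} {g} {h} = sym (⟨⟩-unique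
    (trans (sym assoc) (cong (_∘ h) project₁))
    (trans (sym assoc) (cong (_∘ h) project₂)))

  π₁-∘-⟨⟩ : ∀ {Y X B C} {f : X ⇒ B} {g : X ⇒ C} {h : Y ⇒ X} →
            π₁ ∘ (⟨ f , g ⟩ ∘ h) ≡ f ∘ h
  π₁-∘-⟨⟩ {h = h} = trans (sym assoc) (cong (_∘ h) project₁)

  π₂-∘-⟨⟩ : ∀ {Y X B C} {f : X ⇒ B} {g : X ⇒ C} {h : Y ⇒ X} →
            π₂ ∘ (⟨ f , g ⟩ ∘ h) ≡ g ∘ h
  π₂-∘-⟨⟩ {h = h} = trans (sym assoc) (cong (_∘ h) project₂)

  factorsThroughΔ⇔π₁≡π₂ : ∀ {Y A} (u : Y ⇒ (A ⊗ A)) →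
                          Σ (Y ⇒ A) (λ k → Δ ∘ k ≡ u) ⇔ (π₁ ∘ u ≡ π₂ ∘ u)
  factorsThroughΔ⇔π₁≡π₂ u = mk⇔ to from
    where
    to : Σ _ (λ k → Δ ∘ k ≡ u) → π₁ ∘ u ≡ π₂ ∘ u
    to (k , refl) = begin
      π₁ ∘ (Δ ∘ k)  ≡⟨ π₁-∘-⟨⟩ ⟩
      id ∘ k        ≡⟨ sym π₂-∘-⟨⟩ ⟩
      π₂ ∘ (Δ ∘ k)  ∎

    from : π₁ ∘ u ≡ π₂ ∘ u → Σ _ (λ k → Δ ∘ k ≡ u)
    from eq = π₁ ∘ u , (begin
      Δ ∘ (π₁ ∘ u)                      ≡⟨ ⟨⟩-∘ ⟩
      ⟨ id ∘ (π₁ ∘ u) , id ∘ (π₁ ∘ u) ⟩ ≡⟨ cong₂ ⟨_,_⟩ identityˡ (trans identityˡ eq) ⟩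
      ⟨ π₁ ∘ u , π₂ ∘ u ⟩               ≡⟨ ⟨⟩-unique refl refl ⟩
      u                                 ∎)

module Comprehensions {o ℓ p r} {𝒞 : Category o ℓ} (D : PrimaryDoctrine 𝒞 p r) where
  open Category 𝒞
  open PrimaryDoctrine D

  Pₘ-mono : ∀ {X Y} (h : X ⇒ Y) {α β : P Y} → α ≤ β → Pₘ h α ≤ Pₘ h β
  Pₘ-mono h {α} {β} α≤β =
    subst (λ γ → Pₘ h γ ≤ Pₘ h β) (≤-antisym ∧-lb₁ (∧-glb ≤-refl α≤β))
      (subst (_≤ Pₘ h β) (sym Pₘ-∧) ∧-lb₂)

  ⊤≤-Pₘ : ∀ {X Y} (h : X ⇒ Y) {α : P Y} → ⊤ ≤ α → ⊤ ≤ Pₘ h α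
  ⊤≤-Pₘ h ⊤≤α = subst (_≤ Pₘ h _) Pₘ-⊤ (Pₘ-mono h ⊤≤α)

  isComprehension⇒isWeakComprehension : ∀ {X A} {c : X ⇒ A} {α : P A} →
    IsComprehension D c α → IsWeakComprehension D c α
  isComprehension⇒isWeakComprehension (⊤≤c*α , factor) =
    ⊤≤c*α , λ g ⊤≤g*α → let (h , ch≡g , _) = factor g ⊤≤g*α in h , ch≡g

  ⊤≤Pₘ⇔factors : ∀ {X A Y} {c : X ⇒ A} {α : P A} → IsWeakComprehension D c α →
                 (g : Y ⇒ A) → (⊤ ≤ Pₘ g α) ⇔ Σ (Y ⇒ X) (λ h → c ∘ h ≡ g)
  ⊤≤Pₘ⇔factors {c = c} {α} (⊤≤c*α , factor) g = mk⇔ (factor g) holds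
    where
    holds : Σ _ (λ h → c ∘ h ≡ g) → ⊤ ≤ Pₘ g α
    holds (h , refl) = subst (⊤ ≤_) (sym Pₘ-∘) (⊤≤-Pₘ h ⊤≤c*α)

  Classifies : ∀ {X A} → X ⇒ A → X ⇒ A → P X → Set (o ⊔ ℓ ⊔ r)
  Classifies {X} f g β = ∀ {Y} (h : Y ⇒ X) → (⊤ ≤ Pₘ h β) ⇔ (f ∘ h ≡ g ∘ h)

  module _ {X A} {f g : X ⇒ A} {β : P X} (classifies : Classifies f g β) where

    comprehension⇒equalizer : HasComprehension D β → HasEqualizer 𝒞 f g
    comprehension⇒equalizer (E , e , ⊤≤e*β , factor) =
      E , e , Equivalence.to (classifies e) ⊤≤e*β ,
      λ h fh≡gh → factor h (Equivalence.from (classifies h) fh≡gh)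

    weakComprehension⇒weakEqualizer : ∀ {E} {e : E ⇒ X} →
      IsWeakComprehension D e β → HasWeakEqualizer 𝒞 f g
    weakComprehension⇒weakEqualizer {E} {e} (⊤≤e*β , factor) =
      E , e , Equivalence.to (classifies e) ⊤≤e*β ,
      λ h fh≡gh → factor h (Equivalence.from (classifies h) fh≡gh)

module Equality {o ℓ p r} {𝒞 : Category o ℓ} {FP : FiniteProducts 𝒞}
    {D : PrimaryDoctrine 𝒞 p r} (E : Elementary FP D) {A : Category.Obj 𝒞}
    (Δ-weakComprehension : IsWeakComprehension D (FiniteProducts.Δ FP {A}) (Elementary.δ E {A}))
  where
  open Category 𝒞
  open FiniteProducts FP
  open PrimaryDoctrine D
  open Elementary E using (δ)
  open Products FP
  open Comprehensions D

  ⊤≤δ⇔π₁≡π₂ : ∀ {Y} (u : Y ⇒ (A ⊗ A)) → (⊤ ≤ Pₘ u δ) ⇔ (π₁ ∘ u ≡ π₂ ∘ u)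
  ⊤≤δ⇔π₁≡π₂ u = factorsThroughΔ⇔π₁≡π₂ u ⇔-∘ ⊤≤Pₘ⇔factors Δ-weakComprehension u

  δ-classifiesEqualizers : ∀ {X} (f g : X ⇒ A) → Classifies f g (Pₘ ⟨ f , g ⟩ δ)
  δ-classifiesEqualizers f g h =
    subst (λ φ → φ ⇔ (f ∘ h ≡ g ∘ h)) (cong (⊤ ≤_) Pₘ-∘)
      (subst₂ (λ s t → (⊤ ≤ Pₘ (⟨ f , g ⟩ ∘ h) δ) ⇔ (s ≡ t)) π₁-∘-⟨⟩ π₂-∘-⟨⟩
        (⊤≤δ⇔π₁≡π₂ (⟨ f , g ⟩ ∘ h)))

proposition4p6 : ∀ {o ℓ p r : Level} (𝒞 : Category o ℓ) (FP : FiniteProducts 𝒞)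
    (D : PrimaryDoctrine 𝒞 p r) (E : Elementary FP D) (A : Category.Obj 𝒞) →
    (IsStableComprehension D (FiniteProducts.Δ FP {A}) (Elementary.δ E {A}) →
      ∀ {X} (f g : Category._⇒_ 𝒞 X A) → HasEqualizer 𝒞 f g)
    ×
    (IsStableWeakComprehension D (FiniteProducts.Δ FP {A}) (Elementary.δ E {A}) →
      ∀ {X} (f g : Category._⇒_ 𝒞 X A) → HasWeakEqualizer 𝒞 f g)
proposition4p6 𝒞 FP D E A = equalizers , weakEqualizers
  where
  open Category 𝒞 using (_⇒_)
  open FiniteProducts FP using (Δ; ⟨_,_⟩)
  open Elementary E using (δ)
  open Comprehensions D

  equalizers : IsStableComprehension D Δ δ → ∀ {X} (f g : X ⇒ A) → HasEqualizer 𝒞 f g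
  equalizers (Δ-comprehension , stable) f g =
    comprehension⇒equalizer
      (Equality.δ-classifiesEqualizers E (isComprehension⇒isWeakComprehension Δ-comprehension) f g)
      (stable ⟨ f , g ⟩)

  weakEqualizers : IsStableWeakComprehension D Δ δ →
                   ∀ {X} (f g : X ⇒ A) → HasWeakEqualizer 𝒞 f g
  weakEqualizers (Δ-weakComprehension , stable) f g =
    -- the weak pullback square provided by stability is not needed
    let (_ , _ , _ , e-weakComprehension , _) = stable ⟨ f , g ⟩ in
    weakComprehension⇒weakEqualizer
      (Equality.δ-classifiesEqualizers E Δ-weakComprehension f g)
      e-weakComprehension
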